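{- Let $q$ be an odd prime, $\alpha,\beta\geq 1$ integers, and $\Gamma=\mathrm{Cay}(\mathbb{Z}_{2}\times\mathbb{Z}_{2^{\alpha}q^{\beta}},\Phi)$ with $\Phi=\varphi_2\times\varphi_{2^{\alpha}q^{\beta}}$. Then $\Gamma$ has no connected dominating set, and $\gamma_t(\Gamma)=8$.
   Context: For $n\geq 1$, $\mathbb{Z}_n=\{0,\dots,n-1\}$ is the integers mod $n$ and $\varphi_n$ is the set of elements of $\mathbb{Z}_n$ coprime to $n$. $\mathrm{Cay}(\mathbb{Z}_p\times\mathbb{Z}_m,\varphi_p\times\varphi_m)$ is the graph on $\mathbb{Z}_p\times\mathbb{Z}_m$ where $(u,v)\sim(u',v')$ iff $u-u'\in\varphi_p$ and $v-v'\in\varphi_m$. A total dominating set is a vertex set $T$ such that every vertex is adjacent to some vertex of $T$; $\gamma_t$ is the minimum size of one. A connected dominating set is a dominating set inducing a connected subgraph. -}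

module Defs where

open import Data.Nat using (ℕ; zero; suc; _+_; _∸_; _≤_)
open import Data.Nat.DivMod using (_%_)
open import Data.Nat.Coprimality using (Coprime)
open import Data.Fin using (Fin; toℕ)
open import Data.Sum using (_⊎_)
open import Data.Product using (_×_; _,_; Σ; ∃)
open import Data.List using (List; length)
open import Data.List.Membership.Propositional using (_∈_)
open import Data.List.Relation.Unary.Unique.Propositional using (Unique)
open import Relation.Binary.PropositionalEquality using (_≡_)

-- a ⊖ b : the representative in {0,…,n-1} of (a - b) mod n
_⊖_ : ∀ {n} → Fin n → Fin n → ℕ
_⊖_ {suc n} a b = (toℕ a + (suc n ∸ toℕ b)) % suc n

InPhi : (n : ℕ) → ℕ → Set
InPhi n x = Coprime x n

Vertex : ℕ → ℕ → Set
Vertex p m = Fin p × Fin m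

Adj : (p m : ℕ) → Vertex p m → Vertex p m → Set
Adj p m (u , v) (u' , v') = InPhi p (u ⊖ u') × InPhi m (v ⊖ v')

-- a finite vertex set is a duplicate-free list of vertices
-- total dominating set: every vertex adjacent to some vertex of T
IsTotalDominating : (p m : ℕ) → List (Vertex p m) → Set
IsTotalDominating p m T = ∀ x → ∃ λ t → t ∈ T × Adj p m x t

TotalDominationNumber≡ : (p m : ℕ) → ℕ → Set
TotalDominationNumber≡ p m k =
  (Σ (List (Vertex p m)) λ T → Unique T × IsTotalDominating p m T × length T ≡ k)
  × (∀ (T : List (Vertex p m)) → Unique T → IsTotalDominating p m T → k ≤ length T)

IsDominating : (p m : ℕ) → List (Vertex p m) → Set
IsDominating p m D = ∀ x → x ∈ D ⊎ ∃ λ d → d ∈ D × Adj p m x d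

data WalkIn (p m : ℕ) (D : List (Vertex p m)) : Vertex p m → Vertex p m → Set where
  here : ∀ {x} → x ∈ D → WalkIn p m D x x
  step : ∀ {x y z} → x ∈ D → Adj p m x y → WalkIn p m D y z → WalkIn p m D x z

InducesConnected : (p m : ℕ) → List (Vertex p m) → Set
InducesConnected p m D = (∃ λ d → d ∈ D) × (∀ x y → x ∈ D → y ∈ D → WalkIn p m D x y)

IsConnectedDominating : (p m : ℕ) → List (Vertex p m) → Set
IsConnectedDominating p m D = IsDominating p m D × InducesConnected p m D

-- (u , v) and (u' , w) are adjacent iff u ≠ u' and v, w differ both mod 2 and mod q. So both
-- coordinates of the kind (u , v mod 2) flip along every edge, whether u = v mod 2 is constant
-- on components, and a connected set containing (u , v) cannot dominate (1 - u , v).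
-- A vertex is dominated only by vertices of the opposite kind, and replacing v by v ± q (same
-- residue, other parity) forces a second such dominator; hence each of the four kinds contains
-- two vertices of a total dominating set. Conversely ℤ₂ × {0,1,2,3} totally dominates, as 0, 2
-- and 1, 3 have equal parities but distinct residues mod q.
module Submission where

open import Defs
open import Data.Bool using (Bool)
open import Data.Fin using (Fin; zero; suc; toℕ; fromℕ<; opposite; inject≤; #_)
open import Data.Fin.Properties
  using (_≟_; toℕ<n; toℕ-fromℕ<; toℕ-inject≤; inject≤-injective; fromℕ<-cong; fromℕ<-injective; opposite-involutive)
open import Data.List using (List; []; _∷_; length; map; filter; allFin; cartesianProduct)
open import Data.List.Membership.Propositional using (_∈_)
open import Data.List.Membership.Propositional.Properties
  using (∈-filter⁺; ∈-map⁺; ∈-allFin; ∈-cartesianProduct⁺)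
open import Data.List.Relation.Unary.All as All using ()
open import Data.List.Relation.Unary.AllPairs using (_∷_)
open import Data.List.Relation.Unary.Any using (here; there)
open import Data.List.Relation.Unary.Unique.Propositional using (Unique)
open import Data.List.Relation.Unary.Unique.Propositional.Properties
  using (map⁺; allFin⁺; cartesianProduct⁺)
open import Data.Nat
  using (ℕ; zero; suc; _+_; _*_; _^_; _∸_; _≤_; _<_; z≤n; s≤s; NonZero; >-nonZero)
open import Data.Nat.Coprimality using (Coprime; coprime-divisor)
open import Data.Nat.Divisibility
  using (_∣_; ∣-refl; ∣-trans; ∣1⇒≡1; ∣⇒≤; m∣m*n; n∣m*n; ∣m∣n⇒∣m+n; ∣m+n∣m⇒∣n; ∣n∣m%n⇒∣m; %-presˡ-∣)
open import Data.Nat.DivMod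
  using (_%_; _/_; _mod_; m%n<n; m≡m%n+[m/n]*n; %-remove-+ˡ; %-remove-+ʳ)
open import Data.Nat.Primality
  using (Prime; prime[2]; ¬prime[0]; ¬prime[1]; prime⇒irreducible; prime⇒nonZero)
open import Data.Nat.Properties
  using (+-assoc; +-suc; +-comm; +-identityʳ; +-cancelˡ-≡; +-mono-≤; *-suc; *-mono-≤; *-monoʳ-≤;
         m≤m*n; m≤m+n; m∸n≤m; m∸n+n≡m; m+[n∸m]≡n; m^n≢0; ≤-trans; ≤-<-trans; <⇒≤; ≰⇒>; _≤?_;
         +-monoˡ-<; <-≤-trans; m≤n⇒m≤1+n; module ≤-Reasoning)
open import Data.Product using (_×_; _,_; proj₁; proj₂; ∃; ∃₂)
open import Data.Product.Properties using (≡-dec)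
open import Data.Sum using (inj₁; inj₂)
open import Function using (_∘_)
open import Function.Bundles using (_⇔_; mk⇔; Equivalence)
open import Function.Properties.Equivalence using () renaming (trans to ⇔-trans)
open import Function.Construct.Symmetry using (⇔-sym)
open import Relation.Binary.Definitions using (DecidableEquality)
open import Relation.Binary.PropositionalEquality
  using (_≡_; _≢_; refl; sym; trans; cong; cong₂; subst; ≢-sym; module ≡-Reasoning)
open import Relation.Nullary using (¬_; yes; no; does; contradiction)
open import Relation.Unary using (Decidable)
open import Relation.Unary.Properties using (∁?)

open Equivalence using (to; from)

module _ {e : ℕ} .{{_ : NonZero e}} where

  mod≡mod⇔%≡% : ∀ m n → m mod e ≡ n mod e ⇔ m % e ≡ n % e
  mod≡mod⇔%≡% m n =
    mk⇔ (fromℕ<-injective _ _ (m%n<n m e) (m%n<n n e)) (λ eq → fromℕ<-cong _ _ eq _ _)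

  -- The hypothesis says d ≡ a - b (mod n), written without subtraction.
  ∣⇔mod≡mod : ∀ {n d a b} → e ∣ n → d + b ≡ a + n → e ∣ d ⇔ a mod e ≡ b mod e
  ∣⇔mod≡mod {n} {d} {a} {b} e∣n d+b≡a+n = ⇔-trans (mk⇔ ∣⇒%≡% %≡%⇒∣) (⇔-sym (mod≡mod⇔%≡% a b))
    where
    open ≡-Reasoning

    ∣⇒%≡% : e ∣ d → a % e ≡ b % e
    ∣⇒%≡% e∣d = begin
      a % e       ≡⟨ sym (%-remove-+ʳ a e∣n) ⟩
      (a + n) % e ≡⟨ cong (_% e) (sym d+b≡a+n) ⟩
      (d + b) % e ≡⟨ %-remove-+ˡ b e∣d ⟩
      b % e       ∎

    %≡%⇒∣ : a % e ≡ b % e → e ∣ d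
    %≡%⇒∣ a%≡b% = ∣m+n∣m⇒∣n (subst (e ∣_) (sym quotients) e∣[a/e]e+n) (n∣m*n (b / e))
      where
      r = b % e
      e∣[a/e]e+n : e ∣ a / e * e + n
      e∣[a/e]e+n = ∣m∣n⇒∣m+n (n∣m*n (a / e)) e∣n
      quotients : b / e * e + d ≡ a / e * e + n
      quotients = +-cancelˡ-≡ r _ _ (begin
        r + (b / e * e + d) ≡⟨ cong (r +_) (+-comm (b / e * e) d) ⟩
        r + (d + b / e * e) ≡⟨ sym (+-assoc r d _) ⟩
        r + d + b / e * e   ≡⟨ cong (_+ b / e * e) (+-comm r d) ⟩
        d + r + b / e * e   ≡⟨ +-assoc d r _ ⟩
        d + (r + b / e * e) ≡⟨ cong (d +_) (sym (m≡m%n+[m/n]*n b e)) ⟩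
        d + b               ≡⟨ d+b≡a+n ⟩
        a + n               ≡⟨ cong (_+ n) (m≡m%n+[m/n]*n a e) ⟩
        a % e + a / e * e + n ≡⟨ cong (λ s → s + a / e * e + n) a%≡b% ⟩
        r + a / e * e + n   ≡⟨ +-assoc r _ n ⟩
        r + (a / e * e + n) ∎)

  ∣⇔+-mod≡mod : ∀ d m → e ∣ d ⇔ (d + m) mod e ≡ m mod e
  ∣⇔+-mod≡mod d m = ∣⇔mod≡mod (n∣m*n 0) (sym (+-identityʳ (d + m)))

  ∣⊖⇔mod≡mod : ∀ {n} → e ∣ n → (a b : Fin n) → e ∣ a ⊖ b ⇔ toℕ a mod e ≡ toℕ b mod e
  ∣⊖⇔mod≡mod {suc n} e∣n a b =
    ⇔-trans (mk⇔ (∣n∣m%n⇒∣m e∣n) (λ e∣D → %-presˡ-∣ e∣D e∣n)) (∣⇔mod≡mod e∣n D+b≡a+n)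
    where
    D+b≡a+n : toℕ a + (suc n ∸ toℕ b) + toℕ b ≡ toℕ a + suc n
    D+b≡a+n = trans (+-assoc (toℕ a) _ _) (cong (toℕ a +_) (m∸n+n≡m (<⇒≤ (toℕ<n b))))

coprime-* : ∀ {x m n} → Coprime x m → Coprime x n → Coprime x (m * n)
coprime-* cm cn {i} (i∣x , i∣mn) = cn (i∣x , coprime-divisor i⊥m i∣mn)
  where
  i⊥m : Coprime i _
  i⊥m (j∣i , j∣m) = cm (∣-trans j∣i i∣x , j∣m)

coprime-^ : ∀ {x m} k → Coprime x m → Coprime x (m ^ k)
coprime-^ zero    _  (_ , i∣1) = ∣1⇒≡1 i∣1
coprime-^ (suc k) cm = coprime-* cm (coprime-^ k cm)

∤⇒coprime : ∀ {p x} → Prime p → ¬ p ∣ x → Coprime x p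
∤⇒coprime prime-p p∤x {i} (i∣x , i∣p) with prime⇒irreducible prime-p i∣p
... | inj₁ i≡1 = i≡1
... | inj₂ refl = contradiction i∣x p∤x

odd-prime⇒3≤ : ∀ {p} → Prime p → ¬ 2 ∣ p → 3 ≤ p
odd-prime⇒3≤ {0}             prime-0 _   = contradiction prime-0 ¬prime[0]
odd-prime⇒3≤ {1}             prime-1 _   = contradiction prime-1 ¬prime[1]
odd-prime⇒3≤ {2}             _       2∤2 = contradiction ∣-refl 2∤2
odd-prime⇒3≤ {suc (suc (suc _))} _ _ = s≤s (s≤s (s≤s z≤n))

≢⇒≡opposite : {a b : Fin 2} → a ≢ b → b ≡ opposite a
≢⇒≡opposite {zero}     {zero}     a≢b = contradiction refl a≢b
≢⇒≡opposite {zero}     {suc zero} _   = refl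
≢⇒≡opposite {suc zero} {zero}     _   = refl
≢⇒≡opposite {suc zero} {suc zero} a≢b = contradiction refl a≢b

≢opposite : (a : Fin 2) → a ≢ opposite a
≢opposite zero       ()
≢opposite (suc zero) ()

≢-≢⇒≡ : {a b c : Fin 2} → a ≢ b → b ≢ c → a ≡ c
≢-≢⇒≡ {a} {b} {c} a≢b b≢c = sym (begin
  c                     ≡⟨ ≢⇒≡opposite b≢c ⟩
  opposite b            ≡⟨ cong opposite (≢⇒≡opposite a≢b) ⟩
  opposite (opposite a) ≡⟨ opposite-involutive a ⟩
  a                     ∎)
  where open ≡-Reasoning

toℕ-mod-2 : (a : Fin 2) → toℕ a mod 2 ≡ a
toℕ-mod-2 zero       = refl
toℕ-mod-2 (suc zero) = refl

opposite₂ : Fin 2 × Fin 2 → Fin 2 × Fin 2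
opposite₂ (a , b) = opposite a , opposite b

opposite₂-involutive : ∀ c → opposite₂ (opposite₂ c) ≡ c
opposite₂-involutive (a , b) = cong₂ _,_ (opposite-involutive a) (opposite-involutive b)

side : Fin 2 × Fin 2 → Bool
side (a , b) = does (a ≟ b)

side-opposite₂ : ∀ c → side (opposite₂ c) ≡ side c
side-opposite₂ (zero     , zero    ) = refl
side-opposite₂ (zero     , suc zero) = refl
side-opposite₂ (suc zero , zero    ) = refl
side-opposite₂ (suc zero , suc zero) = refl

side-opposite : ∀ a b → side (opposite a , b) ≢ side (a , b)
side-opposite zero       zero       ()
side-opposite zero       (suc zero) ()
side-opposite (suc zero) zero       ()
side-opposite (suc zero) (suc zero) ()

¬coprime-0-2 : ¬ Coprime 0 2
¬coprime-0-2 c = contradiction (c (n∣m*n 0 , ∣-refl)) λ ()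

coprime-⊖⇔≢ : (u u' : Fin 2) → Coprime (u ⊖ u') 2 ⇔ u ≢ u'
coprime-⊖⇔≢ zero       zero       = mk⇔ (λ c → contradiction c ¬coprime-0-2) (λ u≢u → contradiction refl u≢u)
coprime-⊖⇔≢ zero       (suc zero) = mk⇔ (λ _ ()) (λ _ {_} (d∣1 , _) → ∣1⇒≡1 d∣1)
coprime-⊖⇔≢ (suc zero) zero       = mk⇔ (λ _ ()) (λ _ {_} (d∣1 , _) → ∣1⇒≡1 d∣1)
coprime-⊖⇔≢ (suc zero) (suc zero) = mk⇔ (λ c → contradiction c ¬coprime-0-2) (λ u≢u → contradiction refl u≢u)

record TwoDistinct {A : Set} (P : A → Set) (xs : List A) : Set where
  constructor twoDistinct
  field
    {x y} : A
    x≢y   : x ≢ y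
    x∈xs  : x ∈ xs
    y∈xs  : y ∈ xs
    Px    : P x
    Py    : P y

module _ {A : Set} where

  ∈-∈-≢⇒2≤length : ∀ {x y : A} {xs} → x ∈ xs → y ∈ xs → x ≢ y → 2 ≤ length xs
  ∈-∈-≢⇒2≤length (here refl)       (here refl)       x≢y = contradiction refl x≢y
  ∈-∈-≢⇒2≤length (here _)          (there (here _))  _   = s≤s (s≤s z≤n)
  ∈-∈-≢⇒2≤length (here _)          (there (there _)) _   = s≤s (s≤s z≤n)
  ∈-∈-≢⇒2≤length (there (here _))  (here _)          _   = s≤s (s≤s z≤n)
  ∈-∈-≢⇒2≤length (there (there _)) (here _)          _   = s≤s (s≤s z≤n)
  ∈-∈-≢⇒2≤length (there x∈xs)      (there y∈xs)      x≢y =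
    m≤n⇒m≤1+n (∈-∈-≢⇒2≤length x∈xs y∈xs x≢y)

  length-filter+length-filter-∁ : ∀ {P : A → Set} (P? : Decidable P) xs →
    length (filter P? xs) + length (filter (∁? P?) xs) ≡ length xs
  length-filter+length-filter-∁ P? []       = refl
  length-filter+length-filter-∁ P? (x ∷ xs) with P? x
  ... | yes _ = cong suc (length-filter+length-filter-∁ P? xs)
  ... | no  _ = trans (+-suc _ _) (cong suc (length-filter+length-filter-∁ P? xs))

  filter-TwoDistinct : ∀ {P Q : A → Set} {xs} (Q? : Decidable Q) → (∀ {x} → P x → Q x) →
    TwoDistinct P xs → TwoDistinct P (filter Q? xs)
  filter-TwoDistinct Q? P⇒Q (twoDistinct x≢y x∈xs y∈xs Px Py) =
    twoDistinct x≢y (∈-filter⁺ Q? x∈xs (P⇒Q Px)) (∈-filter⁺ Q? y∈xs (P⇒Q Py)) Px Py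

module _ {A B : Set} (f : A → B) (_≟ᴮ_ : DecidableEquality B) where

  two-per-fibre⇒2*length≤length : ∀ cs xs → Unique cs →
    (∀ {c} → c ∈ cs → TwoDistinct (λ x → f x ≡ c) xs) → 2 * length cs ≤ length xs
  two-per-fibre⇒2*length≤length []       xs _                  _   = z≤n
  two-per-fibre⇒2*length≤length (c ∷ cs) xs (c≢cs ∷ cs-unique) two = begin
    2 * suc (length cs)
      ≡⟨ *-suc 2 (length cs) ⟩
    2 + 2 * length cs
      ≤⟨ +-mono-≤ fibre-c other-fibres ⟩
    length (filter in-c? xs) + length (filter (∁? in-c?) xs)
      ≡⟨ length-filter+length-filter-∁ in-c? xs ⟩
    length xs
      ∎
    where
    open ≤-Reasoning

    in-c? : Decidable (λ x → f x ≡ c)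
    in-c? x = f x ≟ᴮ c

    fibre-c : 2 ≤ length (filter in-c? xs)
    fibre-c with filter-TwoDistinct in-c? (λ fx≡c → fx≡c) (two (here refl))
    ... | twoDistinct x≢y x∈ y∈ _ _ = ∈-∈-≢⇒2≤length x∈ y∈ x≢y

    other-fibres : 2 * length cs ≤ length (filter (∁? in-c?) xs)
    other-fibres = two-per-fibre⇒2*length≤length cs _ cs-unique λ {c'} c'∈cs →
      filter-TwoDistinct (∁? in-c?) (λ fx≡c' fx≡c → All.lookup c≢cs c'∈cs (trans (sym fx≡c) fx≡c'))
        (two (there c'∈cs))

module CayleyZ₂×Z (q M : ℕ) (3≤q : 3 ≤ q) (2∤q : ¬ 2 ∣ q) (2∣M : 2 ∣ M) (q∣M : q ∣ M) (2q≤M : 2 * q ≤ M)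
  (coprime-criterion : ∀ x → ¬ 2 ∣ x → ¬ q ∣ x → Coprime x M) where

  instance
    q-nonZero : NonZero q
    q-nonZero = >-nonZero (≤-trans (s≤s z≤n) 3≤q)

  q∤2 : ¬ q ∣ 2
  q∤2 q∣2 = contradiction (≤-trans 3≤q (∣⇒≤ q∣2)) λ { (s≤s (s≤s ())) }

  4≤M : 4 ≤ M
  4≤M = ≤-trans (≤-trans (m≤m+n 4 2) (*-monoʳ-≤ 2 3≤q)) 2q≤M

  V : Set
  V = Vertex 2 M

  parity : Fin M → Fin 2
  parity v = toℕ v mod 2

  residue : Fin M → Fin q
  residue v = toℕ v mod q

  adjacent⇒ : ∀ u u' v w → Adj 2 M (u , v) (u' , w) →
    u ≢ u' × parity v ≢ parity w × residue v ≢ residue w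
  adjacent⇒ u u' v w (c₂ , cₘ) = to (coprime-⊖⇔≢ u u') c₂ , ≢mod 2∣M (λ ()) , ≢mod q∣M q≢1
    where
    ≢mod : ∀ {e} .{{_ : NonZero e}} → e ∣ M → e ≢ 1 → toℕ v mod e ≢ toℕ w mod e
    ≢mod e∣M e≢1 eq = e≢1 (cₘ (from (∣⊖⇔mod≡mod e∣M v w) eq , e∣M))
    q≢1 : q ≢ 1
    q≢1 q≡1 = contradiction (subst (3 ≤_) q≡1 3≤q) λ { (s≤s ()) }

  ⇒adjacent : ∀ u u' v w → u ≢ u' → parity v ≢ parity w → residue v ≢ residue w →
    Adj 2 M (u , v) (u' , w)
  ⇒adjacent u u' v w u≢u' p≢ r≢ =
    from (coprime-⊖⇔≢ u u') u≢u' ,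
    coprime-criterion _ (p≢ ∘ to (∣⊖⇔mod≡mod 2∣M v w)) (r≢ ∘ to (∣⊖⇔mod≡mod q∣M v w))

  kind : V → Fin 2 × Fin 2
  kind (u , v) = u , parity v

  adjacent⇒kind : ∀ x y → Adj 2 M x y → kind y ≡ opposite₂ (kind x)
  adjacent⇒kind (u , v) (u' , w) adj with adjacent⇒ u u' v w adj
  ... | u≢u' , p≢ , _ = cong₂ _,_ (≢⇒≡opposite u≢u') (≢⇒≡opposite p≢)

  adjacent⇒same-side : ∀ x y → Adj 2 M x y → side (kind x) ≡ side (kind y)
  adjacent⇒same-side x y adj = sym (trans (cong side (adjacent⇒kind x y adj)) (side-opposite₂ (kind x)))

  walk⇒same-side : ∀ {D x y} → WalkIn 2 M D x y → side (kind x) ≡ side (kind y)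
  walk⇒same-side (here _)                  = refl
  walk⇒same-side (step {x} {y} _ adj walk) = trans (adjacent⇒same-side x y adj) (walk⇒same-side walk)

  no-connected-dominating-set : ¬ (∃ λ D → IsConnectedDominating 2 M D)
  no-connected-dominating-set (D , dominating , ((u , v) , d∈D) , connected)
    with dominating (opposite u , v)
  ... | inj₁ x∈D =
    side-opposite u (parity v) (sym (walk⇒same-side (connected _ _ d∈D x∈D)))
  ... | inj₂ (y , y∈D , adj) =
    side-opposite u (parity v)
      (trans (adjacent⇒same-side (opposite u , v) y adj) (sym (walk⇒same-side (connected _ _ d∈D y∈D))))

  translate-mod : ∀ {e} .{{_ : NonZero e}} d {a b : Fin M} → toℕ b ≡ d + toℕ a →
    e ∣ d ⇔ toℕ b mod e ≡ toℕ a mod e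
  translate-mod {e} d {a} b≡d+a =
    subst (λ k → e ∣ d ⇔ k mod e ≡ toℕ a mod e) (sym b≡d+a) (∣⇔+-mod≡mod d (toℕ a))

  q-apart : ∀ {a b : Fin M} → toℕ b ≡ q + toℕ a → residue b ≡ residue a × parity b ≢ parity a
  q-apart b≡q+a = to (translate-mod q b≡q+a) ∣-refl , 2∤q ∘ from (translate-mod q b≡q+a)

  partner : (w : Fin M) → ∃ λ v → residue v ≡ residue w × parity v ≢ parity w
  partner w with q ≤? toℕ w
  ... | yes q≤w = let r≡ , p≢ = q-apart w≡q+v in v , sym r≡ , ≢-sym p≢
    where
    v : Fin M
    v = fromℕ< (≤-<-trans (m∸n≤m (toℕ w) q) (toℕ<n w))
    w≡q+v : toℕ w ≡ q + toℕ v
    w≡q+v = trans (sym (m+[n∸m]≡n q≤w)) (cong (q +_) (sym (toℕ-fromℕ< _)))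
  ... | no q≰w = v , q-apart v≡q+w
    where
    w+q<M : toℕ w + q < M
    w+q<M = <-≤-trans (+-monoˡ-< q (≰⇒> q≰w)) (subst (_≤ M) (cong (q +_) (+-identityʳ q)) 2q≤M)
    v : Fin M
    v = fromℕ< w+q<M
    v≡q+w : toℕ v ≡ q + toℕ w
    v≡q+w = trans (toℕ-fromℕ< _) (+-comm (toℕ w) q)

  kind-surjective : ∀ c → ∃ λ x → kind x ≡ c
  kind-surjective (a , b) = (a , inject≤ b (≤-trans (s≤s (s≤s z≤n)) 4≤M)) ,
    cong (a ,_) (trans (cong (_mod 2) (toℕ-inject≤ b _)) (toℕ-mod-2 b))

  two-of-each-kind : ∀ {T} → IsTotalDominating 2 M T → ∀ c → TwoDistinct (λ t → kind t ≡ c) T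
  two-of-each-kind td c with kind-surjective (opposite₂ c)
  ... | (u , v) , kind≡ with td (u , v)
  ... | (u₁ , w₁) , t₁∈T , adj₁ with partner w₁
  ... | v' , r≡ , p≢ with td (u , v')
  ... | (u₂ , w₂) , t₂∈T , adj₂ =
    twoDistinct t₁≢t₂ t₁∈T t₂∈T (neighbour-kind _ _ kind≡ adj₁) (neighbour-kind _ _ kind'≡ adj₂)
    where
    neighbour-kind : ∀ x t → kind x ≡ opposite₂ c → Adj 2 M x t → kind t ≡ c
    neighbour-kind x t kind≡ adj =
      trans (adjacent⇒kind x t adj) (trans (cong opposite₂ kind≡) (opposite₂-involutive c))
    kind'≡ : kind (u , v') ≡ opposite₂ c
    kind'≡ = trans (cong (u ,_) (≢-≢⇒≡ p≢ (≢-sym (proj₁ (proj₂ (adjacent⇒ u u₁ v w₁ adj₁)))))) kind≡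
    t₁≢t₂ : (u₁ , w₁) ≢ (u₂ , w₂)
    t₁≢t₂ refl = proj₂ (proj₂ (adjacent⇒ u u₂ v' w₂ adj₂)) r≡

  kinds : List (Fin 2 × Fin 2)
  kinds = cartesianProduct (allFin 2) (allFin 2)

  8≤length : ∀ T → IsTotalDominating 2 M T → 8 ≤ length T
  8≤length T td = two-per-fibre⇒2*length≤length kind (≡-dec _≟_ _≟_) kinds T
    (cartesianProduct⁺ (allFin⁺ 2) (allFin⁺ 2)) (λ {c} _ → two-of-each-kind td c)

  ι : Fin 4 → Fin M
  ι i = inject≤ i 4≤M

  toℕ-ι : ∀ i → toℕ (ι i) ≡ toℕ i
  toℕ-ι i = toℕ-inject≤ i 4≤M

  ι-residue-≢ : ∀ i j → toℕ j ≡ 2 + toℕ i → residue (ι i) ≢ residue (ι j)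
  ι-residue-≢ i j j≡2+i r≡ =
    q∤2 (from (translate-mod 2 (trans (toℕ-ι j) (trans j≡2+i (cong (2 +_) (sym (toℕ-ι i)))))) (sym r≡))

  same-parity-pair : (b : Fin 2) →
    ∃₂ λ i j → parity (ι i) ≡ b × parity (ι j) ≡ b × residue (ι i) ≢ residue (ι j)
  same-parity-pair zero =
    # 0 , # 2 , cong (_mod 2) (toℕ-ι (# 0)) , cong (_mod 2) (toℕ-ι (# 2)) , ι-residue-≢ (# 0) (# 2) refl
  same-parity-pair (suc zero) =
    # 1 , # 3 , cong (_mod 2) (toℕ-ι (# 1)) , cong (_mod 2) (toℕ-ι (# 3)) , ι-residue-≢ (# 1) (# 3) refl

  dominators : List V
  dominators = cartesianProduct (allFin 2) (map ι (allFin 4))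

  dominators-unique : Unique dominators
  dominators-unique =
    cartesianProduct⁺ (allFin⁺ 2) (map⁺ (λ {i} {j} → inject≤-injective 4≤M 4≤M i j) (allFin⁺ 4))

  member : ∀ {u} i → (u , ι i) ∈ dominators
  member i = ∈-cartesianProduct⁺ (∈-allFin _) (∈-map⁺ ι (∈-allFin i))

  parity-≢ : ∀ v k → parity k ≡ opposite (parity v) → parity v ≢ parity k
  parity-≢ v k pₖ pᵥ≡pₖ = ≢opposite (parity v) (trans pᵥ≡pₖ pₖ)

  dominators-dominating : IsTotalDominating 2 M dominators
  dominators-dominating (u , v) with same-parity-pair (opposite (parity v))
  ... | i , j , pᵢ , pⱼ , rᵢ≢rⱼ with residue v ≟ residue (ι i)
  ... | no  r≢rᵢ = (opposite u , ι i) , member i ,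
    ⇒adjacent u (opposite u) v (ι i) (≢opposite u) (parity-≢ v (ι i) pᵢ) r≢rᵢ
  ... | yes r≡rᵢ = (opposite u , ι j) , member j ,
    ⇒adjacent u (opposite u) v (ι j) (≢opposite u) (parity-≢ v (ι j) pⱼ) (rᵢ≢rⱼ ∘ trans (sym r≡rᵢ))

  total-domination-number≡8 : TotalDominationNumber≡ 2 M 8
  total-domination-number≡8 =
    (dominators , dominators-unique , dominators-dominating , refl) , λ T _ → 8≤length T

lemma3p2 : ∀ (q α β : ℕ) → Prime q → ¬ (2 ∣ q) → 1 ≤ α → 1 ≤ β →
    (¬ (∃ λ D → IsConnectedDominating 2 (2 ^ α * q ^ β) D))
    × TotalDominationNumber≡ 2 (2 ^ α * q ^ β) 8
lemma3p2 q (suc α) (suc β) prime-q 2∤q (s≤s z≤n) (s≤s z≤n) =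
  no-connected-dominating-set , total-domination-number≡8
  where
  instance
    q-nonZero : NonZero q
    q-nonZero = prime⇒nonZero prime-q

  M : ℕ
  M = 2 ^ suc α * q ^ suc β

  2∣M : 2 ∣ M
  2∣M = ∣-trans (m∣m*n (2 ^ α)) (m∣m*n (q ^ suc β))

  q∣M : q ∣ M
  q∣M = ∣-trans (m∣m*n (q ^ β)) (n∣m*n (2 ^ suc α))

  2q≤M : 2 * q ≤ M
  2q≤M = *-mono-≤ (m≤m*n 2 (2 ^ α) {{m^n≢0 2 α}}) (m≤m*n q (q ^ β) {{m^n≢0 q β}})

  coprime-criterion : ∀ x → ¬ 2 ∣ x → ¬ q ∣ x → Coprime x M
  coprime-criterion x 2∤x q∤x =
    coprime-* (coprime-^ (suc α) (∤⇒coprime prime[2] 2∤x)) (coprime-^ (suc β) (∤⇒coprime prime-q q∤x))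

  open CayleyZ₂×Z q M (odd-prime⇒3≤ prime-q 2∤q) 2∤q 2∣M q∣M 2q≤M coprime-criterion
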